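{- Let $q\ge2$ and $n\ge1$ be integers and let $\Phi\subseteq\mathcal{F}_q$ satisfy $|\Phi|\le n$. Then under each of the scenarios $(*\circ)$, $(\circ *)$, $(**)$, $(\bullet *)$, $(*\bullet)$, and $(\bullet\bullet)$, $\Phi$ is $n$-cell implementable.
   Context: $[b\rangle=\{0,1,\ldots,b-1\}$. Let $\mathbb{B}=\{0,1\}$, $\mathbb{B}_\circ=\mathbb{B}$, $\mathbb{B}_*=\mathbb{B}\cup\{*\}$, $\mathbb{B}_\bullet=\mathbb{B}\cup\{*,\bullet\}$. Define $\mathrm{T}:\mathbb{B}_\bullet^2\to\mathbb{B}$ by $\mathrm{T}(u,\vartheta)=1$ if and only if $u=*$, or $\vartheta=*$, or $u=\vartheta\in\mathbb{B}$. $\mathcal{F}_q$ is the set of all functions $[q\rangle\to\mathbb{B}$. For $\alpha,\beta\in\{\circ,*,\bullet\}$, a subset $\Phi\subseteq\mathcal{F}_q$ is $n$-cell implementable under scenario $(\alpha\beta)$ if there exist mappings $\mathbf{u}=(u_j)_{j\in[n\rangle}:[q\rangle\to\mathbb{B}_\alpha^n$ and $\boldsymbol{\vartheta}=(\vartheta_j)_{j\in[n\rangle}:\Phi\to\mathbb{B}_\beta^n$ such that $f(x)=\bigwedge_{j\in[n\rangle}\mathrm{T}(u_j(x),\vartheta_j(f))$ for all $f\in\Phi$ and $x\in[q\rangle$. -}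

module Defs where

open import Data.Bool using (Bool; true; false; _∧_)
open import Data.Nat using (ℕ)
open import Data.Fin using (Fin)
open import Data.List using (List; length; lookup)
open import Data.Unit using (⊤)
open import Data.Empty using (⊥)
open import Relation.Binary.PropositionalEquality using (_≡_)

data Sym : Set where
  b0 b1 star bullet : Sym

-- Scenario alphabets: ∘ ↦ 𝔹, * ↦ 𝔹 ∪ {*}, • ↦ 𝔹 ∪ {*,•}
data Scen : Set where
  circ st bul : Scen

Allowed : Scen → Sym → Set
Allowed circ b0     = ⊤
Allowed circ b1     = ⊤
Allowed circ star   = ⊥
Allowed circ bullet = ⊥
Allowed st   b0     = ⊤
Allowed st   b1     = ⊤
Allowed st   star   = ⊤
Allowed st   bullet = ⊥
Allowed bul  _      = ⊤

T : Sym → Sym → Bool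
T star _      = true
T _    star   = true
T b0   b0     = true
T b1   b1     = true
T _    _      = false

bigAnd : (n : ℕ) → (Fin n → Bool) → Bool
bigAnd ℕ.zero    g = true
bigAnd (ℕ.suc n) g = g Fin.zero ∧ bigAnd n (λ j → g (Fin.suc j))

𝓕 : ℕ → Set
𝓕 q = Fin q → Bool

-- Φ ⊆ 𝓕_q represented as a duplicate-free list; elements indexed by position.
-- n-cell implementable under scenario (αβ):
--   ∃ u : [q⟩ → 𝔹_α^n, ϑ : Φ → 𝔹_β^n with f(x) = ⋀_j T(u_j(x), ϑ_j(f)).
record Implementable (α β : Scen) (q n : ℕ) (Φ : List (𝓕 q)) : Set where
  field
    u     : Fin q → Fin n → Sym
    ϑ     : Fin (length Φ) → Fin n → Sym
    u-ok  : ∀ x j → Allowed α (u x j)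
    ϑ-ok  : ∀ i j → Allowed β (ϑ i j)
    impl  : ∀ i x → lookup Φ i x ≡ bigAnd n (λ j → T (u x j) (ϑ i j))

{-# OPTIONS --safe #-}
module Submission where

-- Reserve cell i for the i-th function f_i of Φ: let u_i(x) encode the bit f_i(x), and let
-- ϑ(f_i) "select" cell i and "ignore" every other cell. Then the conjunction over the cells
-- collapses to T(u_i(x), select) = f_i(x). The symbols (*, 0 ; select 1, ignore 0) realise
-- this under (*∘), the symbols (bit ; select 1, ignore *) under (∘*), and the remaining four
-- scenarios only enlarge the alphabets of (*∘).

open import Defs
open import Data.Nat using (ℕ; zero; suc; _≤_)
open import Data.List using (List; []; _∷_; length; lookup)
open import Data.List.Relation.Unary.AllPairs using (AllPairs)
open import Data.Fin using (Fin; toℕ; inject≤; _≟_)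
open import Data.Fin.Properties using (suc-injective; toℕ-inject≤)
open import Data.Bool using (Bool; true; false; _∧_; if_then_else_)
open import Data.Bool.Properties using (∧-identityʳ)
open import Data.Product using (_×_; _,_)
open import Data.Unit using (tt)
open import Function using (_∘_)
open import Relation.Nullary using (¬_; does)
open import Relation.Nullary.Decidable using (dec-true; dec-false)
open import Relation.Binary.PropositionalEquality

bigAnd-true : (n : ℕ) (g : Fin n → Bool) → (∀ j → g j ≡ true) → bigAnd n g ≡ true
bigAnd-true zero    g all = refl
bigAnd-true (suc n) g all rewrite all Fin.zero = bigAnd-true n (g ∘ Fin.suc) (all ∘ Fin.suc)

bigAnd-single : (n : ℕ) (g : Fin n → Bool) (k : Fin n) →
                (∀ j → ¬ j ≡ k → g j ≡ true) → bigAnd n g ≡ g k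
bigAnd-single (suc n) g Fin.zero others =
  trans (cong (g Fin.zero ∧_) (bigAnd-true n (g ∘ Fin.suc) (λ j → others (Fin.suc j) λ ())))
        (∧-identityʳ (g Fin.zero))
bigAnd-single (suc n) g (Fin.suc k) others rewrite others Fin.zero (λ ()) =
  bigAnd-single n (g ∘ Fin.suc) k (λ j j≢k → others (Fin.suc j) (j≢k ∘ suc-injective))

_⊑_ : Scen → Scen → Set
α ⊑ β = ∀ s → Allowed α s → Allowed β s

⊑-refl : ∀ {α} → α ⊑ α
⊑-refl s allowed = allowed

circ⊑st : circ ⊑ st
circ⊑st b0 _ = tt
circ⊑st b1 _ = tt

⊑bul : ∀ {α} → α ⊑ bul
⊑bul s _ = tt

implementable-widen : ∀ {α α′ β β′ q n Φ} → α ⊑ α′ → β ⊑ β′ →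
                      Implementable α β q n Φ → Implementable α′ β′ q n Φ
implementable-widen α⊑α′ β⊑β′ I = record
  { u = u ; ϑ = ϑ
  ; u-ok = λ x j → α⊑α′ (u x j) (u-ok x j)
  ; ϑ-ok = λ i j → β⊑β′ (ϑ i j) (ϑ-ok i j)
  ; impl = impl }
  where open Implementable I

record CellScheme (α β : Scen) : Set where
  field
    encode : Bool → Sym
    select ignore pad : Sym
    encode-allowed : ∀ b → Allowed α (encode b)
    pad-allowed    : Allowed α pad
    select-allowed : Allowed β select
    ignore-allowed : Allowed β ignore
    T-encode-select : ∀ b → T (encode b) select ≡ b
    T-encode-ignore : ∀ b → T (encode b) ignore ≡ true
    T-pad-ignore    : T pad ignore ≡ true

module _ {α β : Scen} (S : CellScheme α β) {q : ℕ} where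
  open CellScheme S

  column : List (𝓕 q) → ℕ → Fin q → Sym
  column []      _       x = pad
  column (f ∷ Φ) zero    x = encode (f x)
  column (f ∷ Φ) (suc m) x = column Φ m x

  column-lookup : ∀ Φ (i : Fin (length Φ)) x → column Φ (toℕ i) x ≡ encode (lookup Φ i x)
  column-lookup (f ∷ Φ) Fin.zero    x = refl
  column-lookup (f ∷ Φ) (Fin.suc i) x = column-lookup Φ i x

  column-ind : (P : Sym → Set) → (∀ b → P (encode b)) → P pad → ∀ Φ m x → P (column Φ m x)
  column-ind P P-encode P-pad []      m       x = P-pad
  column-ind P P-encode P-pad (f ∷ Φ) zero    x = P-encode (f x)
  column-ind P P-encode P-pad (f ∷ Φ) (suc m) x = column-ind P P-encode P-pad Φ m x

  scheme-implementable : (n : ℕ) (Φ : List (𝓕 q)) → length Φ ≤ n → Implementable α β q n Φ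
  scheme-implementable n Φ |Φ|≤n = record
    { u = u ; ϑ = ϑ
    ; u-ok = λ x j → column-ind (Allowed α) encode-allowed pad-allowed Φ (toℕ j) x
    ; ϑ-ok = λ i j → ϑ-allowed (does (cell i ≟ j))
    ; impl = λ i x → sym (conjunction-selects i x) }
    where
    cell : Fin (length Φ) → Fin n
    cell i = inject≤ i |Φ|≤n

    u : Fin q → Fin n → Sym
    u x j = column Φ (toℕ j) x

    ϑ : Fin (length Φ) → Fin n → Sym
    ϑ i j = if does (cell i ≟ j) then select else ignore

    ϑ-allowed : ∀ b → Allowed β (if b then select else ignore)
    ϑ-allowed true  = select-allowed
    ϑ-allowed false = ignore-allowed

    selected-cell : ∀ i x → T (u x (cell i)) (ϑ i (cell i)) ≡ lookup Φ i x
    selected-cell i x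
      rewrite dec-true (cell i ≟ cell i) refl
            | toℕ-inject≤ i |Φ|≤n
            | column-lookup Φ i x = T-encode-select (lookup Φ i x)

    ignored-cell : ∀ i x j → ¬ j ≡ cell i → T (u x j) (ϑ i j) ≡ true
    ignored-cell i x j j≢cell rewrite dec-false (cell i ≟ j) (j≢cell ∘ sym) =
      column-ind (λ s → T s ignore ≡ true) T-encode-ignore T-pad-ignore Φ (toℕ j) x

    conjunction-selects : ∀ i x → bigAnd n (λ j → T (u x j) (ϑ i j)) ≡ lookup Φ i x
    conjunction-selects i x =
      trans (bigAnd-single n _ (cell i) (ignored-cell i x)) (selected-cell i x)

star-scheme : CellScheme st circ
star-scheme = record
  { encode = λ b → if b then star else b0
  ; select = b1 ; ignore = b0 ; pad = star
  ; encode-allowed = λ { true → tt ; false → tt }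
  ; pad-allowed = tt ; select-allowed = tt ; ignore-allowed = tt
  ; T-encode-select = λ { true → refl ; false → refl }
  ; T-encode-ignore = λ { true → refl ; false → refl }
  ; T-pad-ignore = refl }

bit-scheme : CellScheme circ st
bit-scheme = record
  { encode = λ b → if b then b1 else b0
  ; select = b1 ; ignore = star ; pad = b0
  ; encode-allowed = λ { true → tt ; false → tt }
  ; pad-allowed = tt ; select-allowed = tt ; ignore-allowed = tt
  ; T-encode-select = λ { true → refl ; false → refl }
  ; T-encode-ignore = λ { true → refl ; false → refl }
  ; T-pad-ignore = refl }

proposition2 : (q n : ℕ) → 2 ≤ q → 1 ≤ n → (Φ : List (𝓕 q))
    → AllPairs (λ f g → ¬ (∀ x → f x ≡ g x)) Φ
    → length Φ ≤ n
    → Implementable st circ q n Φ × Implementable circ st q n Φ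
      × Implementable st st q n Φ × Implementable bul st q n Φ
      × Implementable st bul q n Φ × Implementable bul bul q n Φ
proposition2 q n _ _ Φ _ |Φ|≤n =
    star-circ
  , scheme-implementable bit-scheme n Φ |Φ|≤n
  , implementable-widen ⊑-refl circ⊑st star-circ
  , implementable-widen ⊑bul   circ⊑st star-circ
  , implementable-widen ⊑-refl ⊑bul    star-circ
  , implementable-widen ⊑bul   ⊑bul    star-circ
  where
  star-circ : Implementable st circ q n Φ
  star-circ = scheme-implementable star-scheme n Φ |Φ|≤n
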